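{- Let $G$ be a connected $\{K_{1,3},Z_{2},N\}$-free graph which contains an induced subgraph $H=H_{7}$. Then for each vertex $a\in V(G)\setminus V(H)$ with $N_{G}(a)\cap V(H)\neq\emptyset$, $N_{G}(a)\cap V(H)=\{y_{1},y_{2},y_{7},y_{8}\}$. Consequently, $G[V(H)\cup\{a\}]\cong H_{8}$.
   Context: All graphs are finite and simple; $N_G(a)$ is the neighborhood of $a$, $G[X]$ the induced subgraph. $\mathcal{F}$-free means no member of $\mathcal{F}$ is an induced subgraph. $K_{1,3}$ is the star with three leaves; $Z_2$ is a triangle $abc$ plus a path $ade$ on new vertices $d,e$; $N$ is a triangle with one new pendant vertex attached to each of its three vertices. $H_7$: vertices $y_1,\dots,y_8$, edges $y_1y_2,y_1y_3,y_1y_5,y_2y_4,y_2y_6,y_3y_4,y_3y_5,y_3y_7,y_4y_6,y_4y_7,y_5y_6,y_5y_8,y_6y_8,y_7y_8$; the induced subgraph $H$ is identified with $H_7$ via these labels. $H_8$: the graph obtained from $H_7$ by adding one new vertex adjacent exactly to $y_1,y_2,y_7,y_8$. -}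

module Defs where

open import Data.Nat using (ℕ; suc)
open import Data.Fin using (Fin; zero; suc; _≟_)
open import Data.Fin.Patterns
open import Data.Bool using (Bool; true; false; _∨_; _∧_; not)
open import Data.Bool.Properties using (∨-comm)
open import Data.List using (List; []; _∷_)
open import Data.Bool.ListAction using (any)
open import Data.Product using (Σ; _×_; _,_)
open import Relation.Nullary using (¬_; does; yes; no)
open import Relation.Binary.PropositionalEquality using (_≡_; refl; sym; cong₂)
open import Function.Definitions using (Injective)

record Graph : Set where
  field
    n      : ℕ
    adj    : Fin n → Fin n → Bool
    adj-sym    : ∀ u v → adj u v ≡ adj v u
    adj-irrefl : ∀ v → adj v v ≡ false

open Graph public

V : Graph → Set
V G = Fin (n G)

IsInducedEmbedding : (F G : Graph) → (V F → V G) → Set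
IsInducedEmbedding F G f =
  Injective _≡_ _≡_ f × (∀ u v → adj G (f u) (f v) ≡ adj F u v)

_≤ᵢ_ : Graph → Graph → Set
F ≤ᵢ G = Σ (V F → V G) (IsInducedEmbedding F G)

Free : Graph → Graph → Set
Free F G = ¬ (F ≤ᵢ G)

data Walk (G : Graph) : V G → V G → Set where
  here : ∀ {u} → Walk G u u
  step : ∀ {u v w} → adj G u v ≡ true → Walk G v w → Walk G u w

Connected : Graph → Set
Connected G = ∀ u v → Walk G u v

_==_ : ∀ {k} → Fin k → Fin k → Bool
u == v = does (u ≟ v)

==-sym : ∀ {k} (u v : Fin k) → (u == v) ≡ (v == u)
==-sym u v with u ≟ v | v ≟ u
... | yes _ | yes _ = refl
... | no _  | no _  = refl
... | yes p | no q  = Data.Empty.⊥-elim (q (sym p))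
  where import Data.Empty
... | no p  | yes q = Data.Empty.⊥-elim (p (sym q))
  where import Data.Empty

==-refl : ∀ {k} (u : Fin k) → (u == u) ≡ true
==-refl u with u ≟ u
... | yes _ = refl
... | no p  = Data.Empty.⊥-elim (p refl)
  where import Data.Empty

listed : ∀ {k} → List (Fin k × Fin k) → Fin k → Fin k → Bool
listed es u v = any (λ { (a , b) → (a == u) ∧ (b == v) }) es

edgeAdj : ∀ {k} → List (Fin k × Fin k) → Fin k → Fin k → Bool
edgeAdj es u v = not (u == v) ∧ (listed es u v ∨ listed es v u)

fromEdges : (k : ℕ) → List (Fin k × Fin k) → Graph
fromEdges k es = record
  { n = k
  ; adj = edgeAdj es
  ; adj-sym = λ u v → cong₂ (λ x y → not x ∧ y) (==-sym u v) (∨-comm (listed es u v) (listed es v u))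
  ; adj-irrefl = λ v → irr v
  }
  where
  irr : ∀ v → edgeAdj es v v ≡ false
  irr v rewrite ==-refl v = refl

K13 : Graph
K13 = fromEdges 4 ((0F , 1F) ∷ (0F , 2F) ∷ (0F , 3F) ∷ [])

-- Z_2: triangle a b c = 0 1 2, path a d e = 0 3 4.
Z2 : Graph
Z2 = fromEdges 5 ((0F , 1F) ∷ (1F , 2F) ∷ (0F , 2F) ∷ (0F , 3F) ∷ (3F , 4F) ∷ [])

NGraph : Graph
NGraph = fromEdges 6 ((0F , 1F) ∷ (1F , 2F) ∷ (0F , 2F) ∷ (0F , 3F) ∷ (1F , 4F) ∷ (2F , 5F) ∷ [])

-- y_i is the vertex (i-1) : Fin 8 (resp. Fin 9).
H7edges : ∀ {k} → (Fin 8 → Fin k) → List (Fin k × Fin k)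
H7edges y =
    (y 0F , y 1F) ∷ (y 0F , y 2F) ∷ (y 0F , y 4F) ∷ (y 1F , y 3F) ∷ (y 1F , y 5F)
  ∷ (y 2F , y 3F) ∷ (y 2F , y 4F) ∷ (y 2F , y 6F) ∷ (y 3F , y 5F) ∷ (y 3F , y 6F)
  ∷ (y 4F , y 5F) ∷ (y 4F , y 7F) ∷ (y 5F , y 7F) ∷ (y 6F , y 7F) ∷ []

H7 : Graph
H7 = fromEdges 8 (H7edges (λ i → i))

H8 : Graph
H8 = fromEdges 9 (H7edges Data.Fin.inject₁
  Data.List.++ ((8F , 0F) ∷ (8F , 1F) ∷ (8F , 6F) ∷ (8F , 7F) ∷ []))
  where import Data.List

inY1278 : Fin 8 → Bool
inY1278 0F = true
inY1278 1F = true
inY1278 6F = true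
inY1278 7F = true
inY1278 _  = false

extend : ∀ {m} → (Fin 8 → Fin m) → Fin m → Fin 9 → Fin m
extend h a 8F = a
extend h a 0F = h 0F
extend h a 1F = h 1F
extend h a 2F = h 2F
extend h a 3F = h 3F
extend h a 4F = h 4F
extend h a 5F = h 5F
extend h a 6F = h 6F
extend h a 7F = h 7F

-- Label a new vertex a as 0 and y_k as k. Whether the graph H_7 + a
-- contains an induced K_{1,3} or Z_2 depends only on which y_k are adjacent
-- to a, so the theorem is a finite check over the 2^8 possible traces of
-- N(a) on H. Every trace except the empty one and {y_1, y_2, y_7, y_8}
-- yields a claw or a Z_2 through a, and 21 such witnesses, each fixing only
-- the 3 or 4 adjacencies of a that it uses, cover all of them.
module Submission where

open import Defs
open import Data.Nat using (suc)
open import Data.Fin using (Fin; zero; suc; _≟_)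
open import Data.Fin.Patterns
open import Data.Fin.Properties using (all?)
open import Data.Bool using (Bool; true; false)
import Data.Bool.Properties as Bool
open import Data.Vec using (Vec; []; _∷_; lookup; tabulate)
open import Data.Vec.Properties using (lookup∘tabulate)
import Data.Vec.Functional as Vector
open import Data.Product using (Σ; _×_; _,_)
open import Data.Empty using (⊥-elim)
open import Function using (_∘_)
open import Function.Definitions using (Injective)
open import Relation.Nullary using (¬_; Dec; map′)
open import Relation.Nullary.Decidable using (True; toWitness; _×-dec_; _→-dec_)
open import Relation.Binary.PropositionalEquality
  using (_≡_; refl; sym; trans; cong; cong₂)

embedding-∘ : ∀ {F K G} {f : V F → V K} {g : V K → V G} →
  IsInducedEmbedding K G g → IsInducedEmbedding F K f →
  IsInducedEmbedding F G (g ∘ f)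
embedding-∘ (g-inj , g-adj) (f-inj , f-adj) =
  f-inj ∘ g-inj , λ u v → trans (g-adj _ _) (f-adj u v)

≤ᵢ-trans : ∀ {F K G} → F ≤ᵢ K → K ≤ᵢ G → F ≤ᵢ G
≤ᵢ-trans {F} {K} {G} (f , f-emb) (g , g-emb) =
  g ∘ f , embedding-∘ {F} {K} {G} g-emb f-emb

embedding-cong : ∀ {F G} {f g : V F → V G} → (∀ u → f u ≡ g u) →
  IsInducedEmbedding F G f → IsInducedEmbedding F G g
embedding-cong {F} {G} f≗g (f-inj , f-adj) =
  (λ {u} {v} e → f-inj (trans (f≗g u) (trans e (sym (f≗g v))))) ,
  λ u v → trans (sym (cong₂ (adj G) (f≗g u) (f≗g v))) (f-adj u v)

injective? : ∀ {F G} (f : V F → V G) → Dec (Injective _≡_ _≡_ f)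
injective? f =
  map′ (λ inj {u} {v} → inj u v) (λ inj u v → inj {u} {v})
       (all? λ u → all? λ v → (f u ≟ f v) →-dec (u ≟ v))

embedding? : (F G : Graph) (f : V F → V G) → Dec (IsInducedEmbedding F G f)
embedding? F G f =
  injective? {F} {G} f ×-dec
  all? λ u → all? λ v → adj G (f u) (f v) Bool.≟ adj F u v

addVertex : (F : Graph) → (V F → Bool) → Graph
addVertex F b = record
  { n = suc (n F) ; adj = A ; adj-sym = A-sym ; adj-irrefl = A-irrefl }
  where
  A : Fin (suc (n F)) → Fin (suc (n F)) → Bool
  A zero    zero    = false
  A zero    (suc j) = b j
  A (suc i) zero    = b i
  A (suc i) (suc j) = adj F i j

  A-sym : ∀ u v → A u v ≡ A v u
  A-sym zero    zero    = refl
  A-sym zero    (suc j) = refl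
  A-sym (suc i) zero    = refl
  A-sym (suc i) (suc j) = adj-sym F i j

  A-irrefl : ∀ v → A v v ≡ false
  A-irrefl zero    = refl
  A-irrefl (suc i) = adj-irrefl F i

addVertex-embedding : ∀ {F G} {h : V F → V G} → IsInducedEmbedding F G h →
  (a : V G) → (∀ i → ¬ h i ≡ a) →
  (b : V F → Bool) → (∀ i → adj G a (h i) ≡ b i) →
  IsInducedEmbedding (addVertex F b) G (a Vector.∷ h)
addVertex-embedding {F} {G} {h} (h-inj , h-adj) a a∉h b a~h = inj , adjacency
  where
  inj : Injective _≡_ _≡_ (a Vector.∷ h)
  inj {zero}  {zero}  _ = refl
  inj {zero}  {suc j} e = ⊥-elim (a∉h j (sym e))
  inj {suc i} {zero}  e = ⊥-elim (a∉h i e)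
  inj {suc i} {suc j} e = cong suc (h-inj e)

  adjacency : ∀ u v →
    adj G ((a Vector.∷ h) u) ((a Vector.∷ h) v) ≡ adj (addVertex F b) u v
  adjacency zero    zero    = adj-irrefl G a
  adjacency zero    (suc j) = a~h j
  adjacency (suc i) zero    = trans (adj-sym G (h i) a) (a~h i)
  adjacency (suc i) (suc j) = h-adj i j

extend-natural : ∀ {m k} (g : Fin m → Fin k) (h : Fin 8 → Fin m) a u →
  g (extend h a u) ≡ extend (g ∘ h) (g a) u
extend-natural g h a 0F = refl
extend-natural g h a 1F = refl
extend-natural g h a 2F = refl
extend-natural g h a 3F = refl
extend-natural g h a 4F = refl
extend-natural g h a 5F = refl
extend-natural g h a 6F = refl
extend-natural g h a 7F = refl
extend-natural g h a 8F = refl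

H8-embedding : IsInducedEmbedding H8 (addVertex H7 inY1278) (extend suc zero)
H8-embedding =
  toWitness {a? = embedding? H8 (addVertex H7 inY1278) (extend suc zero)} _

data Outcome (b : Fin 8 → Bool) : Set where
  isolated       : (∀ i → b i ≡ false) → Outcome b
  adjacent-y1278 : (∀ i → b i ≡ inY1278 i) → Outcome b
  claw           : K13 ≤ᵢ addVertex H7 b → Outcome b
  z2             : Z2 ≤ᵢ addVertex H7 b → Outcome b

-- Checking a witness only evaluates b at the vertices it uses, so the
-- clauses of classify may leave every other bit of b open.
module _ {b : Fin 8 → Bool} where

  claw-at : (f : Vec (Fin 9) 4) →
    {True (embedding? K13 (addVertex H7 b) (lookup f))} → Outcome b
  claw-at f {ok} = claw (lookup f , toWitness ok)

  z2-at : (f : Vec (Fin 9) 5) →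
    {True (embedding? Z2 (addVertex H7 b) (lookup f))} → Outcome b
  z2-at f {ok} = z2 (lookup f , toWitness ok)

classify : (b : Vec Bool 8) → Outcome (lookup b)
classify (false ∷ false ∷ false ∷ false ∷ false ∷ false ∷ false ∷ false ∷ []) =
  isolated (toWitness {a? = all? λ i → _ Bool.≟ false} _)
classify (true ∷ true ∷ false ∷ false ∷ false ∷ false ∷ true ∷ true ∷ []) =
  adjacent-y1278 (toWitness {a? = all? λ i → _ Bool.≟ inY1278 i} _)
classify (_ ∷ _ ∷ _ ∷ _ ∷ false ∷ _ ∷ false ∷ true ∷ []) = claw-at (8F ∷ 0F ∷ 5F ∷ 7F ∷ [])
classify (_ ∷ _ ∷ false ∷ _ ∷ _ ∷ _ ∷ true ∷ false ∷ []) = claw-at (7F ∷ 0F ∷ 3F ∷ 8F ∷ [])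
classify (false ∷ _ ∷ _ ∷ _ ∷ true ∷ false ∷ _ ∷ _ ∷ []) = claw-at (5F ∷ 0F ∷ 1F ∷ 6F ∷ [])
classify (_ ∷ false ∷ _ ∷ _ ∷ _ ∷ true ∷ _ ∷ false ∷ []) = claw-at (6F ∷ 0F ∷ 2F ∷ 8F ∷ [])
classify (true ∷ _ ∷ _ ∷ true ∷ _ ∷ _ ∷ _ ∷ true ∷ []) = claw-at (0F ∷ 1F ∷ 4F ∷ 8F ∷ [])
classify (_ ∷ _ ∷ true ∷ false ∷ false ∷ _ ∷ _ ∷ _ ∷ []) = claw-at (3F ∷ 0F ∷ 4F ∷ 5F ∷ [])
classify (_ ∷ true ∷ _ ∷ _ ∷ true ∷ _ ∷ true ∷ _ ∷ []) = claw-at (0F ∷ 2F ∷ 5F ∷ 7F ∷ [])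
classify (_ ∷ true ∷ _ ∷ _ ∷ _ ∷ true ∷ false ∷ false ∷ []) = z2-at (6F ∷ 0F ∷ 2F ∷ 8F ∷ 7F ∷ [])
classify (_ ∷ _ ∷ _ ∷ true ∷ _ ∷ false ∷ false ∷ _ ∷ []) = claw-at (4F ∷ 0F ∷ 6F ∷ 7F ∷ [])
classify (false ∷ _ ∷ _ ∷ _ ∷ false ∷ _ ∷ true ∷ true ∷ []) = z2-at (8F ∷ 0F ∷ 7F ∷ 5F ∷ 1F ∷ [])
classify (_ ∷ _ ∷ _ ∷ false ∷ true ∷ _ ∷ false ∷ true ∷ []) = z2-at (8F ∷ 0F ∷ 5F ∷ 7F ∷ 4F ∷ [])
classify (_ ∷ false ∷ _ ∷ false ∷ _ ∷ _ ∷ true ∷ true ∷ []) = z2-at (7F ∷ 0F ∷ 8F ∷ 4F ∷ 2F ∷ [])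
classify (_ ∷ _ ∷ _ ∷ true ∷ false ∷ _ ∷ true ∷ false ∷ []) = z2-at (7F ∷ 0F ∷ 4F ∷ 8F ∷ 5F ∷ [])
classify (true ∷ _ ∷ _ ∷ false ∷ true ∷ false ∷ _ ∷ _ ∷ []) = z2-at (5F ∷ 0F ∷ 1F ∷ 6F ∷ 4F ∷ [])
classify (false ∷ false ∷ _ ∷ _ ∷ _ ∷ true ∷ _ ∷ true ∷ []) = z2-at (6F ∷ 0F ∷ 8F ∷ 2F ∷ 1F ∷ [])
classify (_ ∷ true ∷ false ∷ false ∷ _ ∷ _ ∷ false ∷ _ ∷ []) = z2-at (4F ∷ 3F ∷ 7F ∷ 2F ∷ 0F ∷ [])
classify (_ ∷ _ ∷ _ ∷ false ∷ false ∷ true ∷ _ ∷ _ ∷ []) = claw-at (6F ∷ 0F ∷ 4F ∷ 5F ∷ [])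
classify (false ∷ _ ∷ true ∷ _ ∷ _ ∷ _ ∷ false ∷ _ ∷ []) = claw-at (3F ∷ 0F ∷ 1F ∷ 7F ∷ [])
classify (true ∷ false ∷ false ∷ _ ∷ _ ∷ _ ∷ _ ∷ _ ∷ []) = claw-at (1F ∷ 0F ∷ 2F ∷ 3F ∷ [])
classify (_ ∷ _ ∷ false ∷ _ ∷ _ ∷ true ∷ false ∷ true ∷ []) = z2-at (8F ∷ 0F ∷ 6F ∷ 7F ∷ 3F ∷ [])
classify (_ ∷ _ ∷ true ∷ _ ∷ _ ∷ false ∷ true ∷ false ∷ []) = z2-at (7F ∷ 0F ∷ 3F ∷ 8F ∷ 6F ∷ [])

lemma2p8 : (G : Graph) → Connected G
    → Free K13 G → Free Z2 G → Free NGraph G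
    → (h : Fin 8 → V G) → IsInducedEmbedding H7 G h
    → (a : V G) → (∀ i → ¬ (h i ≡ a))
    → Σ (Fin 8) (λ i → adj G a (h i) ≡ true)
    → (∀ i → adj G a (h i) ≡ inY1278 i)
    × IsInducedEmbedding H8 G (extend h a)
lemma2p8 G _ claw-free z2-free _ h h-emb a a∉h (i , a~hᵢ) =
  conclude (classify (tabulate (adj G a ∘ h)))
  where
  b : Fin 8 → Bool
  b = lookup (tabulate (adj G a ∘ h))

  a~h : ∀ j → adj G a (h j) ≡ b j
  a~h j = sym (lookup∘tabulate (adj G a ∘ h) j)

  extension : ∀ {c} → (∀ j → adj G a (h j) ≡ c j) →
    IsInducedEmbedding (addVertex H7 c) G (a Vector.∷ h)
  extension = addVertex-embedding {H7} {G} h-emb a a∉h _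

  conclude : Outcome b →
    (∀ j → adj G a (h j) ≡ inY1278 j) × IsInducedEmbedding H8 G (extend h a)
  conclude (isolated none) with trans (sym a~hᵢ) (trans (a~h i) (none i))
  ... | ()
  conclude (adjacent-y1278 nb) =
    a~y1278 ,
    embedding-cong {H8} {G} (extend-natural (a Vector.∷ h) suc zero)
      (embedding-∘ {H8} {addVertex H7 inY1278} {G}
        (extension a~y1278) H8-embedding)
    where
    a~y1278 : ∀ j → adj G a (h j) ≡ inY1278 j
    a~y1278 j = trans (a~h j) (nb j)
  conclude (claw e) =
    ⊥-elim (claw-free (≤ᵢ-trans {K13} {addVertex H7 b} {G} e (_ , extension a~h)))
  conclude (z2 e) =
    ⊥-elim (z2-free (≤ᵢ-trans {Z2} {addVertex H7 b} {G} e (_ , extension a~h)))
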